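{- Let $G$ be a finite simple graph and let $G\overline{G}$ be its complementary prism. Let $u \in V(G)$ be such that $u$ is a simplicial vertex of $G$ and its corresponding vertex $\overline{u}$ is a simplicial vertex of $\overline{G}$. Then every hull set $S$ of $G\overline{G}$ (in the geodetic convexity) satisfies $S \cap \{u, \overline{u}\} \neq \emptyset$.
   Context: All graphs are finite, simple and undirected. For a graph $H$ and $x,y \in V(H)$, the closed interval $I[x,y]$ consists of $x$, $y$ and all vertices lying on some shortest path between $x$ and $y$ in $H$; for $S \subseteq V(H)$, $I[S] = \bigcup_{x,y\in S} I[x,y]$. A set $S$ is (geodetically) convex if $I[S]=S$. The convex hull $H(S)$ is the smallest convex set containing $S$ (equivalently, the limit of iterating $S \mapsto I[S]$). $S$ is a hull set of $H$ if $H(S)=V(H)$. A vertex $v$ is simplicial in a graph if its closed neighborhood induces a clique. For a graph $G$ with vertex set $\{v_1,\dots,v_n\}$, the complementary prism $G\overline{G}$ has vertex set $\{v_1,\dots,v_n\}\cup\{\overline{v}_1,\dots,\overline{v}_n\}$ and edge set $E(G) \cup \{\overline{v}_i\overline{v}_j : i<j,\ v_iv_j\notin E(G)\} \cup \{v_i\overline{v}_i : 1\le i\le n\}$; i.e. it is the disjoint union of $G$ and its complement $\overline{G}$ (on the vertices $\overline{v}_i$) together with the perfect matching $v_i\overline{v}_i$. The vertex $\overline{v}$ is called the vertex corresponding to $v$. -}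

module Defs where

open import Data.Nat using (ℕ; zero; suc; _<_)
open import Data.Fin using (Fin)
open import Data.Bool using (Bool; true; false; not)
open import Data.Sum using (_⊎_; inj₁; inj₂)
open import Data.Product using (Σ; _×_; ∃-syntax)
open import Data.Empty using (⊥)
open import Relation.Binary.PropositionalEquality using (_≡_; _≢_)
open import Relation.Nullary using (¬_)

record Graph (n : ℕ) : Set where
  field
    adj   : Fin n → Fin n → Bool
    sym   : ∀ x y → adj x y ≡ adj y x
    irrefl : ∀ x → adj x x ≡ false

open Graph public

module Geodesic {V : Set} (E : V → V → Set) where

  data Walk : V → V → ℕ → Set where
    here : ∀ {x} → Walk x x zero
    step : ∀ {x y z k} → E x y → Walk y z k → Walk x z (suc k)

  Dist : V → V → ℕ → Set
  Dist x y k = Walk x y k × (∀ j → j < k → ¬ Walk x y j)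

  InInterval : V → V → V → Set
  InInterval x y z = ∃[ k ] ∃[ a ] ∃[ b ]
    (Dist x y k × Walk x z a × Walk z y b × (a Data.Nat.+ b ≡ k))

  Subset : Set₁
  Subset = V → Set

  Convex : Subset → Set
  Convex C = ∀ x y z → C x → C y → InInterval x y z → C z

  HullSet : Subset → Set₁
  HullSet S = ∀ (C : Subset) → Convex C → (∀ v → S v → C v) → ∀ v → C v

Adj : ∀ {n} → Graph n → Fin n → Fin n → Set
Adj G x y = adj G x y ≡ true

Simplicial : ∀ {n} → (Fin n → Fin n → Set) → Fin n → Set
Simplicial E u = ∀ x y → (x ≡ u ⊎ E u x) → (y ≡ u ⊎ E u y) → x ≢ y → E x y

CoAdj : ∀ {n} → Graph n → Fin n → Fin n → Set
CoAdj G x y = (x ≢ y) × (adj G x y ≡ false)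

-- complementary prism G Ḡ: inj₁ v is v ∈ V(G), inj₂ v is v̄
PrismAdj : ∀ {n} → Graph n → (Fin n ⊎ Fin n) → (Fin n ⊎ Fin n) → Set
PrismAdj G (inj₁ x) (inj₁ y) = Adj G x y
PrismAdj G (inj₂ x) (inj₂ y) = CoAdj G x y
PrismAdj G (inj₁ x) (inj₂ y) = x ≡ y
PrismAdj G (inj₂ x) (inj₁ y) = x ≡ y

module Submission where

-- Write u and ū for the two copies of u in the
-- complementary prism G Ḡ, and call {u, ū} the fibre over u.  We show that
-- the set of vertices off the fibre is convex; a hull set contained in it
-- would then generate a convex set missing u, so every hull set meets
-- {u, ū}.
--
-- Convexity comes from a local notion: a vertex w is *avoidable* for a
-- set A if every walk from A to A passing through w can be replaced by a
-- strictly shorter one.  Then w lies on no shortest path between vertices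
-- of A, so the complement of a set of avoidable vertices is convex.

open import Defs hiding (sym)
open import Data.Nat using (ℕ; suc; _+_; _<_; s≤s)
open import Data.Nat.Properties using (≤-refl; ≤-reflexive; +-suc; +-monoʳ-≤; n≤1+n; m<n⇒m<1+n)
open import Data.Fin using (Fin; _≟_)
open import Data.Sum using (_⊎_; inj₁; inj₂; swap; reduce)
open import Data.Sum.Properties using (swap-involutive)
open import Data.Bool using (Bool; true; false)
open import Data.Product using (_×_; _,_; ∃-syntax)
open import Data.Empty using (⊥; ⊥-elim)
open import Function using (id)
open import Relation.Binary.PropositionalEquality
  using (_≡_; _≢_; refl; sym; trans; cong; subst; subst₂)
open import Relation.Nullary using (¬_; yes; no)

-- Removing one or two edges from a walk of length (a + 1) + (b + 1).
drop-one : ∀ a b → a + suc b < suc a + suc b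
drop-one a b = ≤-refl

drop-two : ∀ a b → a + b < suc a + suc b
drop-two a b = s≤s (+-monoʳ-≤ a (n≤1+n b))

module WalkFacts {V : Set} (E : V → V → Set) where
  open Geodesic E

  infixr 5 _++_
  _++_ : ∀ {x y z a b} → Walk x y a → Walk y z b → Walk x z (a + b)
  here       ++ w = w
  step e w′  ++ w = step e (w′ ++ w)

  unsnoc : ∀ {x z a} → Walk x z (suc a) → ∃[ p ] Walk x p a × E p z
  unsnoc (step e here) = _ , here , e
  unsnoc (step e (step e′ w)) with unsnoc (step e′ w)
  ... | p , w′ , e″ = p , step e w′ , e″

  Shorter : V → V → ℕ → Set
  Shorter x y k = ∃[ j ] j < k × Walk x y j

  Avoidable : (V → Set) → V → Set
  Avoidable A w = ∀ {x y a b} → A x → A y →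
    Walk x w a → Walk w y b → Shorter x y (a + b)

  Bypassable : (V → Set) → V → Set
  Bypassable A w = ∀ {x y p q a b} → A x → A y →
    Walk x p a → E p w → E w q → Walk q y b → Shorter x y (suc a + suc b)

  -- If w ∉ A, a walk through w between vertices of A enters and leaves w.
  bypassable⇒avoidable : ∀ {A w} → (∀ {x} → A x → x ≢ w) →
    Bypassable A w → Avoidable A w
  bypassable⇒avoidable w∉A bypass Ax Ay here _ = ⊥-elim (w∉A Ax refl)
  bypassable⇒avoidable w∉A bypass Ax Ay (step _ _) here = ⊥-elim (w∉A Ay refl)
  bypassable⇒avoidable w∉A bypass Ax Ay wxw@(step _ _) (step ewq wqy)
    with unsnoc wxw
  ... | p , wxp , epw = bypass Ax Ay wxp epw ewq wqy

  avoidable⇒outside-interval : ∀ {A w x y} → Avoidable A w → A x → A y →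
    ¬ InInterval x y w
  avoidable⇒outside-interval avoid Ax Ay (k , a , b , (_ , minimal) , wxw , wwy , a+b≡k)
    with avoid Ax Ay wxw wwy
  ... | j , j<a+b , wxy = minimal j (subst (j <_) a+b≡k j<a+b) wxy

  complement-convex : (B : V → Set) →
    (∀ w → B w → Avoidable (λ v → ¬ B v) w) → Convex (λ v → ¬ B v)
  complement-convex B avoid x y z ¬Bx ¬By z∈I[x,y] Bz =
    avoidable⇒outside-interval (avoid z Bz) ¬Bx ¬By z∈I[x,y]

map-walk : ∀ {V W} {E : V → V → Set} {F : W → W → Set} (f : V → W) →
  (∀ {x y} → E x y → F (f x) (f y)) →
  ∀ {x y k} → Geodesic.Walk E x y k → Geodesic.Walk F (f x) (f y) k
map-walk f hom Geodesic.here = Geodesic.here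
map-walk f hom (Geodesic.step e w) = Geodesic.step (hom e) (map-walk f hom w)

avoidable-transport : ∀ {V W} {E : V → V → Set} {F : W → W → Set}
  {A : V → Set} {B : W → Set} (f : V → W) (g : W → V) →
  (∀ {x y} → E x y → F (f x) (f y)) → (∀ {x y} → F x y → E (g x) (g y)) →
  (∀ x → g (f x) ≡ x) → (∀ {x} → A x → B (f x)) →
  ∀ {w} → WalkFacts.Avoidable F B (f w) → WalkFacts.Avoidable E A w
avoidable-transport f g homf homg gf≡id A⇒B avoid Ax Ay wxw wwy
  with avoid (A⇒B Ax) (A⇒B Ay) (map-walk f homf wxw) (map-walk f homf wwy)
... | j , j<k , wxy = j , j<k , subst₂ (λ x y → Geodesic.Walk _ x y j)
                                       (gf≡id _) (gf≡id _) (map-walk g homg wxy)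

Prism : ∀ {n} → (Fin n → Fin n → Set) → (Fin n → Fin n → Set) →
  Fin n ⊎ Fin n → Fin n ⊎ Fin n → Set
Prism E₁ E₂ (inj₁ x) (inj₁ y) = E₁ x y
Prism E₁ E₂ (inj₂ x) (inj₂ y) = E₂ x y
Prism E₁ E₂ (inj₁ x) (inj₂ y) = x ≡ y
Prism E₁ E₂ (inj₂ x) (inj₁ y) = x ≡ y

record Complementary {n} (E₁ E₂ : Fin n → Fin n → Set) : Set where
  field
    sym₁       : ∀ {x y} → E₁ x y → E₁ y x
    sym₂       : ∀ {x y} → E₂ x y → E₂ y x
    exclusive  : ∀ {x y} → E₁ x y → E₂ x y → ⊥
    exhaustive : ∀ {x y} → x ≢ y → E₁ x y ⊎ E₂ x y

complementary-swap : ∀ {n} {E₁ E₂ : Fin n → Fin n → Set} →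
  Complementary E₁ E₂ → Complementary E₂ E₁
complementary-swap c = record
  { sym₁ = sym₂ ; sym₂ = sym₁
  ; exclusive = λ e₂ e₁ → exclusive e₁ e₂
  ; exhaustive = λ x≢y → swap (exhaustive x≢y) }
  where open Complementary c

prism-swap : ∀ {n} {E₁ E₂ : Fin n → Fin n → Set} {v w} →
  Prism E₁ E₂ v w → Prism E₂ E₁ (swap v) (swap w)
prism-swap {v = inj₁ _} {inj₁ _} e = e
prism-swap {v = inj₁ _} {inj₂ _} e = e
prism-swap {v = inj₂ _} {inj₁ _} e = e
prism-swap {v = inj₂ _} {inj₂ _} e = e

InFibre : ∀ {n} → Fin n → Fin n ⊎ Fin n → Set
InFibre u v = reduce v ≡ u

OffFibre : ∀ {n} → Fin n → Fin n ⊎ Fin n → Set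
OffFibre u v = ¬ InFibre u v

off-fibre-swap : ∀ {n} {u : Fin n} {v} → OffFibre u v → OffFibre u (swap v)
off-fibre-swap {v = inj₁ _} off = off
off-fibre-swap {v = inj₂ _} off = off

module PrismWalks {n} {E₁ E₂ : Fin n → Fin n → Set} (comp : Complementary E₁ E₂) where
  open Complementary comp
  open Geodesic (Prism E₁ E₂)
  open WalkFacts (Prism E₁ E₂)

  cross : ∀ {c q} → c ≢ q → Walk (inj₂ c) (inj₁ q) 2
  cross {c} {q} c≢q with exhaustive c≢q
  ... | inj₁ e = step {y = inj₁ c} refl (step e here)
  ... | inj₂ e = step {y = inj₂ q} e (step refl here)

  cross′ : ∀ {p c} → p ≢ c → Walk (inj₁ p) (inj₂ c) 2
  cross′ {p} {c} p≢c with exhaustive p≢c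
  ... | inj₁ e = step {y = inj₁ c} e (step refl here)
  ... | inj₂ e = step {y = inj₂ p} refl (step e here)

  separated : ∀ {c u q} → E₂ c u → E₁ u q → c ≢ q
  separated e₂ e₁ refl = exclusive (sym₁ e₁) e₂

  -- Neighbours p, q of u on the walk are either both in E₁ (join
  -- them, or skip u), or one of them is ū; then u is skipped together
  -- with ū and its other neighbour c̄, using the detour of length 2.
  module _ (u : Fin n) (simplicial : Simplicial E₁ u) where

    bypass-left : Bypassable (OffFibre u) (inj₁ u)
    bypass-left {p = inj₁ p} {inj₁ q} {a} {b} _ _ wxp epu euq wqy with p ≟ q
    ... | yes refl = a + b , drop-two a b , wxp ++ wqy
    ... | no p≢q   = a + suc b , drop-one a b ,
                     wxp ++ step (simplicial p q (inj₂ (sym₁ epu)) (inj₂ euq) p≢q) wqy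
    bypass-left {p = inj₂ _} {inj₂ _} {a} {b} _ _ wxp refl refl wqy =
      a + b , drop-two a b , wxp ++ wqy
    bypass-left {p = inj₂ _} {inj₁ _} x∉F _ here refl euq wqy = ⊥-elim (x∉F refl)
    bypass-left {p = inj₂ _} {inj₁ _} {suc a} {b} _ _ wxū@(step _ _) refl euq wqy
      with unsnoc wxū
    ... | inj₁ _ , wxu , refl = a + suc b , m<n⇒m<1+n (drop-one a b) , wxu ++ step euq wqy
    ... | inj₂ _ , wxc̄ , ecu  = a + suc (suc b) ,
          ≤-reflexive (cong suc (+-suc a (suc b))) ,
          wxc̄ ++ cross (separated ecu euq) ++ wqy
    bypass-left {p = inj₁ _} {inj₂ _} _ y∉F wxp epu refl here = ⊥-elim (y∉F refl)
    bypass-left {p = inj₁ _} {inj₂ _} {a} {suc b} _ _ wxp epu refl (step {y = inj₁ _} refl wuy) =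
      a + suc b , drop-two a (suc b) , wxp ++ step epu wuy
    bypass-left {p = inj₁ _} {inj₂ _} {a} {suc b} _ _ wxp epu refl (step {y = inj₂ _} euc wc̄y) =
      a + suc (suc b) , drop-one a (suc b) ,
      wxp ++ cross′ (λ p≡c → separated (sym₂ euc) (sym₁ epu) (sym p≡c)) ++ wc̄y

    avoidable-left : Avoidable (OffFibre u) (inj₁ u)
    avoidable-left = bypassable⇒avoidable (λ { x∉F refl → x∉F refl }) bypass-left

fibre-avoidable : ∀ {n} {E₁ E₂ : Fin n → Fin n → Set} (u : Fin n) →
  Complementary E₁ E₂ → Simplicial E₁ u → Simplicial E₂ u →
  ∀ w → InFibre u w → WalkFacts.Avoidable (Prism E₁ E₂) (OffFibre u) w
fibre-avoidable u comp simp₁ simp₂ (inj₁ _) refl =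
  PrismWalks.avoidable-left comp u simp₁
fibre-avoidable {E₁ = E₁} {E₂} u comp simp₁ simp₂ (inj₂ _) refl =
  avoidable-transport swap swap (λ {v w} → prism-swap {E₁ = E₁} {E₂} {v} {w})
    (λ {v w} → prism-swap {E₁ = E₂} {E₁} {v} {w}) swap-involutive
    (λ {v} → off-fibre-swap {u = u} {v})
    (PrismWalks.avoidable-left (complementary-swap comp) u simp₂)

complementary-graph : ∀ {n} (G : Graph n) → Complementary (Adj G) (CoAdj G)
complementary-graph G = record
  { sym₁ = λ {x} {y} e → trans (Graph.sym G y x) e
  ; sym₂ = λ {x} {y} (x≢y , e) → (λ y≡x → x≢y (sym y≡x)) , trans (Graph.sym G y x) e
  ; exclusive = λ e₁ (_ , e₂) → true≢false (trans (sym e₁) e₂)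
  ; exhaustive = exhaustive }
  where
  true≢false : true ≢ false
  true≢false ()
  exhaustive : ∀ {x y} → x ≢ y → Adj G x y ⊎ CoAdj G x y
  exhaustive {x} {y} x≢y with adj G x y
  ... | true  = inj₁ refl
  ... | false = inj₂ (x≢y , refl)

prism-to : ∀ {n} (G : Graph n) {v w} → PrismAdj G v w → Prism (Adj G) (CoAdj G) v w
prism-to G {inj₁ _} {inj₁ _} e = e
prism-to G {inj₁ _} {inj₂ _} e = e
prism-to G {inj₂ _} {inj₁ _} e = e
prism-to G {inj₂ _} {inj₂ _} e = e

prism-from : ∀ {n} (G : Graph n) {v w} → Prism (Adj G) (CoAdj G) v w → PrismAdj G v w
prism-from G {inj₁ _} {inj₁ _} e = e
prism-from G {inj₁ _} {inj₂ _} e = e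
prism-from G {inj₂ _} {inj₁ _} e = e
prism-from G {inj₂ _} {inj₂ _} e = e

off-fibre-convex : ∀ {n} (G : Graph n) (u : Fin n) →
  Simplicial (Adj G) u → Simplicial (CoAdj G) u →
  Geodesic.Convex (PrismAdj G) (OffFibre u)
off-fibre-convex G u simp simp̄ =
  WalkFacts.complement-convex (PrismAdj G) (InFibre u) λ w w∈F →
    avoidable-transport id id (prism-to G) (prism-from G) (λ _ → refl) id
      (fibre-avoidable u (complementary-graph G) simp simp̄ w w∈F)

lemma2 : ∀ {n} (G : Graph n) (u : Fin n) →
    Simplicial (Adj G) u → Simplicial (CoAdj G) u →
    (S : Fin n ⊎ Fin n → Bool) →
    Geodesic.HullSet (PrismAdj G) (λ v → S v ≡ true) →
    (S (inj₁ u) ≡ true) ⊎ (S (inj₂ u) ≡ true)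
lemma2 G u simp simp̄ S hull with S (inj₁ u) in Su | S (inj₂ u) in Sū
... | true  | _     = inj₁ refl
... | false | true  = inj₂ refl
... | false | false =
  ⊥-elim (hull (OffFibre u) (off-fibre-convex G u simp simp̄) S⊆off (inj₁ u) refl)
  where
  S⊆off : ∀ v → S v ≡ true → OffFibre u v
  S⊆off (inj₁ _) Sv refl with () ← trans (sym Sv) Su
  S⊆off (inj₂ _) Sv refl with () ← trans (sym Sv) Sū
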